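{- Let $L_{\mathcal{L}}\subseteq\{0,1\}^*$ be the set of all binary words that are Lyndon words with respect to the order $0<1$ or with respect to the order $1<0$, and let $L=\{w\in L_{\mathcal{L}}\mid |w|\text{ is odd}\}$. Then $\mathcal{G}_L$ is exactly the class of bipartite graphs.
   Context: All graphs are finite, simple, undirected, with nonempty vertex sets, and graph classes are considered up to isomorphism; a graph is bipartite if its vertex set is the union of two disjoint independent sets. Given a strict linear order on an alphabet, extended lexicographically to words (a proper prefix is smaller), a Lyndon word is a nonempty word $w$ that is not of the form $u^k$ with $k\geq 2$ and that is lexicographically smallest among its conjugates (words $vu$ where $w=uv$). For an alphabet $V$ and distinct $u,v\in V$, $h_{u,v}:V^*\to\{0,1\}^*$ is the monoid morphism with $u\mapsto 0$, $v\mapsto 1$ and $x\mapsto\lambda$ (empty word) for all other letters $x$. For a language $L\subseteq\{0,1\}^*$ closed under exchanging 0 and 1 and a nonempty word $w$ whose set of occurring letters is $V$, $G(L,w)$ is the graph with vertex set $V$ in which distinct $u,v$ are adjacent iff $h_{u,v}(w)\in L$. $\mathcal{G}_L$ is the class of all graphs isomorphic to some $G(L,w)$. -}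

module Defs where

open import Data.Nat using (ℕ; zero; suc; _+_; _*_; _≥_)
open import Data.Bool using (Bool; true; false)
open import Data.Fin using (Fin)
open import Data.Fin.Properties using (_≟_)
open import Data.List using (List; []; _∷_; _++_; length; concat; replicate)
open import Data.List.Membership.Propositional using (_∈_)
open import Data.Product using (Σ; ∃; _×_; _,_)
open import Data.Sum using (_⊎_)
open import Data.Empty using (⊥)
open import Relation.Nullary using (¬_; yes; no)
open import Relation.Binary.PropositionalEquality using (_≡_; _≢_)
open import Function.Bundles using (_⤖_; Bijection; _⇔_)

-- Binary words: 0 is false, 1 is true.

BinWord : Set
BinWord = List Bool

data _<₀₁_ : Bool → Bool → Set where
  f<t : false <₀₁ true

data _<₁₀_ : Bool → Bool → Set where
  t<f : true <₁₀ false

data Lex< (_≺_ : Bool → Bool → Set) : BinWord → BinWord → Set where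
  prefix : ∀ {y ys} → Lex< _≺_ [] (y ∷ ys)
  here   : ∀ {x y xs ys} → x ≺ y → Lex< _≺_ (x ∷ xs) (y ∷ ys)
  there  : ∀ {x xs ys} → Lex< _≺_ xs ys → Lex< _≺_ (x ∷ xs) (x ∷ ys)

Lex≤ : (Bool → Bool → Set) → BinWord → BinWord → Set
Lex≤ _≺_ u v = Lex< _≺_ u v ⊎ u ≡ v

IsPower : BinWord → Set
IsPower w = Σ BinWord λ u → Σ ℕ λ k → (k ≥ 2) × (w ≡ concat (replicate k u))

Lyndon : (Bool → Bool → Set) → BinWord → Set
Lyndon _≺_ w =
  (w ≢ []) × (¬ IsPower w) ×
  (∀ u v → w ≡ u ++ v → Lex≤ _≺_ w (v ++ u))

LyndonEither : BinWord → Set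
LyndonEither w = Lyndon _<₀₁_ w ⊎ Lyndon _<₁₀_ w

OddNat : ℕ → Set
OddNat n = Σ ℕ λ k → n ≡ suc (2 * k)

LOdd : BinWord → Set
LOdd w = LyndonEither w × OddNat (length w)

h : ∀ {m} → Fin m → Fin m → List (Fin m) → BinWord
h u v [] = []
h u v (x ∷ xs) with x ≟ u | x ≟ v
... | yes _ | _     = false ∷ h u v xs
... | no _  | yes _ = true ∷ h u v xs
... | no _  | no _  = h u v xs

GAdj : (BinWord → Set) → ∀ {m} → List (Fin m) → Fin m → Fin m → Set
GAdj L w u v = (u ≢ v) × L (h u v w)

record Graph : Set where
  field
    pred-n : ℕ
    adj    : Fin (suc pred-n) → Fin (suc pred-n) → Bool
    sym    : ∀ x y → adj x y ≡ adj y x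
    irrefl : ∀ x → adj x x ≡ false

open Graph public

Vtx : Graph → Set
Vtx G = Fin (suc (pred-n G))

Adj : (G : Graph) → Vtx G → Vtx G → Set
Adj G x y = adj G x y ≡ true

Bipartite : Graph → Set
Bipartite G = Σ (Vtx G → Bool) λ c → ∀ x y → Adj G x y → c x ≢ c y

InClass : (BinWord → Set) → Graph → Set
InClass L G =
  Σ ℕ λ m → Σ (List (Fin m)) λ w →
    (w ≢ []) × (∀ a → a ∈ w) ×
    Σ (Vtx G ⤖ Fin m) λ f →
      ∀ x y → Adj G x y ⇔ GAdj L w (Bijection.to f x) (Bijection.to f y)

-- Since |h_{u,v}(w)| = |w|_u + |w|_v, the word h_{u,v}(w) has odd length exactly when the
-- numbers of occurrences of u and v have different parities; colouring each letter by the
-- parity of its number of occurrences therefore makes every graph of 𝒢_L bipartite.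
--
-- Conversely, given a proper 2-colouring c, take the word
--   (each true vertex three times) (each false vertex once)² ∏_{true v} (v v N(v))²
-- with N(v) listing the neighbours of v. Its occurrence parities are given by c, so only pairs
-- of different colours can be adjacent. For a true and b false, h_{a,b} of it is 00011
-- followed by one piece per true v: 001001 or 0000 for v = a according as ab is an edge or
-- not, and 11 or nothing for v ≠ a. A word 0001R with R built from the blocks 1 and 001 is
-- Lyndon for 0 < 1, since every proper rotation meets a 1 within its first three letters; a
-- factor 0000 spoils minimality for 0 < 1, and the leading 0 does so for 1 < 0. Pairs in the
-- order (b, a) follow because L is closed under exchanging 0 and 1.

module Submission where

open import Data.Bool using (Bool; true; false; not; _xor_; if_then_else_)
open import Data.Bool.Properties using (not-distribˡ-xor; xor-same; xor-identityʳ; not-involutive)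
open import Data.Empty using (⊥-elim)
open import Data.Fin using (Fin; zero; suc)
open import Data.Fin.Properties using (_≟_; suc-injective)
open import Data.List using (List; []; _∷_; _++_; length; concat; replicate; tabulate; map; filter)
open import Data.List.Properties
  using (++-assoc; ++-identityʳ; ∷-injectiveˡ; ∷-injectiveʳ; map-++; map-∘; map-cong; map-id;
         map-replicate; concat-map; length-map; length-++; filter-++; filter-all; filter-none)
open import Data.List.Membership.Propositional using (_∈_)
open import Data.List.Membership.Propositional.Properties using (∈-++⁺ˡ; ∈-++⁺ʳ; ∈-concat⁺′; ∈-tabulate⁺)
open import Data.List.Relation.Unary.All.Properties using (replicate⁺)
open import Data.List.Relation.Unary.Any using (here)
open import Data.Nat using (ℕ; zero; suc; _+_; _*_; s≤s)
open import Data.Nat.Properties using (+-suc; +-identityʳ; *-suc)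
open import Data.Product using (_,_; ∃; ∃₂)
open import Data.Sum using (inj₁; inj₂)
open import Function using (_∘_)
open import Function.Bundles using (_⇔_; mk⇔; Equivalence; Bijection)
open import Function.Construct.Identity using (⤖-id)
open import Relation.Nullary using (¬_; Dec; yes; no)
open import Relation.Binary.PropositionalEquality
  using (_≡_; _≢_; refl; sym; trans; cong; cong₂; subst; module ≡-Reasoning)

open import Defs hiding (sym)

open ≡-Reasoning

odd : ℕ → Bool
odd zero    = false
odd (suc n) = not (odd n)

odd-+ : ∀ m n → odd (m + n) ≡ odd m xor odd n
odd-+ zero    n = refl
odd-+ (suc m) n = trans (cong not (odd-+ m n)) (not-distribˡ-xor (odd m) (odd n))

odd-+-same : ∀ n → odd (n + n) ≡ false
odd-+-same n = trans (odd-+ n n) (xor-same (odd n))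

OddNat⇒odd : ∀ {n} → OddNat n → odd n ≡ true
OddNat⇒odd (k , refl) = cong not (trans (cong (λ m → odd (k + m)) (+-identityʳ k)) (odd-+-same k))

not≡⇒≡not : ∀ {x y} → not x ≡ y → x ≡ not y
not≡⇒≡not {x} refl = sym (not-involutive x)

odd⇒OddNat : ∀ {n} → odd n ≡ true → OddNat n
¬odd⇒double : ∀ {n} → odd n ≡ false → ∃ λ k → n ≡ 2 * k

odd⇒OddNat {suc n} e = let k , n≡2k = ¬odd⇒double (not≡⇒≡not e) in k , cong suc n≡2k

¬odd⇒double {zero}  _ = 0 , refl
¬odd⇒double {suc n} e =
  let k , n≡1+2k = odd⇒OddNat (not≡⇒≡not e) in suc k , trans (cong suc n≡1+2k) (sym (*-suc 2 k))

concat-replicate-[] : ∀ {A : Set} k → concat (replicate k ([] {A = A})) ≡ []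
concat-replicate-[] zero    = refl
concat-replicate-[] (suc k) = concat-replicate-[] k

concat-replicate-rotate : ∀ {A : Set} k (u : List A) →
  concat (replicate k u) ++ u ≡ u ++ concat (replicate k u)
concat-replicate-rotate zero    u = sym (++-identityʳ u)
concat-replicate-rotate (suc k) u = begin
  (u ++ concat (replicate k u)) ++ u  ≡⟨ ++-assoc u _ u ⟩
  u ++ (concat (replicate k u) ++ u)  ≡⟨ cong (u ++_) (concat-replicate-rotate k u) ⟩
  u ++ (u ++ concat (replicate k u))  ∎

module _ {_≺_ : Bool → Bool → Set} (≺-irrefl : ∀ x → ¬ x ≺ x) where

  Lex<-irrefl : ∀ w → ¬ Lex< _≺_ w w
  Lex<-irrefl (x ∷ w) (here x≺x) = ≺-irrefl x x≺x
  Lex<-irrefl (x ∷ w) (there w<w) = Lex<-irrefl w w<w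

  Lex≤-first-difference : ∀ s {x y r r′} → x ≢ y →
    Lex≤ _≺_ (s ++ x ∷ r) (s ++ y ∷ r′) → x ≺ y
  Lex≤-first-difference []      x≢y (inj₁ (here x≺y)) = x≺y
  Lex≤-first-difference []      x≢y (inj₁ (there _))  = ⊥-elim (x≢y refl)
  Lex≤-first-difference []      x≢y (inj₂ eq)         = ⊥-elim (x≢y (∷-injectiveˡ eq))
  Lex≤-first-difference (z ∷ s) x≢y (inj₁ (here z≺z)) = ⊥-elim (≺-irrefl z z≺z)
  Lex≤-first-difference (z ∷ s) x≢y (inj₁ (there lt)) = Lex≤-first-difference s x≢y (inj₁ lt)
  Lex≤-first-difference (z ∷ s) x≢y (inj₂ eq)         =
    Lex≤-first-difference s x≢y (inj₂ (∷-injectiveʳ eq))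

  rotations-above⇒Lyndon : ∀ {w} → w ≢ [] →
    (∀ u v → u ≢ [] → v ≢ [] → w ≡ u ++ v → Lex< _≺_ w (v ++ u)) → Lyndon _≺_ w
  rotations-above⇒Lyndon {w} w≢[] above = w≢[] , not-power , minimal
    where
    -- u ++ uᵏ and uᵏ ++ u are the same word, so a proper power equals one of its rotations.
    not-power : ¬ IsPower w
    not-power (_ , zero , () , _)
    not-power (_ , suc zero , s≤s () , _)
    not-power ([] , suc (suc k) , _ , w≡) = w≢[] (trans w≡ (concat-replicate-[] k))
    not-power (x ∷ u , suc (suc k) , _ , w≡) =
      Lex<-irrefl w (subst (Lex< _≺_ w) rotation≡w (above (x ∷ u) _ (λ ()) (λ ()) w≡))
      where
      rotation≡w : concat (replicate (suc k) (x ∷ u)) ++ x ∷ u ≡ w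
      rotation≡w = trans (concat-replicate-rotate (suc k) (x ∷ u)) (sym w≡)

    minimal : ∀ u v → w ≡ u ++ v → Lex≤ _≺_ w (v ++ u)
    minimal []      v       w≡ = inj₂ (trans w≡ (sym (++-identityʳ v)))
    minimal (x ∷ u) []      w≡ = inj₂ (trans w≡ (++-identityʳ (x ∷ u)))
    minimal (x ∷ u) (y ∷ v) w≡ = inj₁ (above (x ∷ u) (y ∷ v) (λ ()) (λ ()) w≡)

-- Exchanging 0 and 1

complement : BinWord → BinWord
complement = map not

complement-involutive : ∀ w → complement (complement w) ≡ w
complement-involutive w = trans (sym (map-∘ w)) (trans (map-cong not-involutive w) (map-id w))

complement-power : ∀ k u → complement (concat (replicate k u)) ≡ concat (replicate k (complement u))
complement-power k u =
  trans (sym (concat-map (replicate k u))) (cong concat (map-replicate complement k u))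

IsPower-complement : ∀ {w} → IsPower w → IsPower (complement w)
IsPower-complement {w} (u , k , k≥2 , w≡) =
  complement u , k , k≥2 , trans (cong complement w≡) (complement-power k u)

module _ {_≺_ _≺′_ : Bool → Bool → Set} (not-mono : ∀ {x y} → x ≺ y → not x ≺′ not y) where

  Lex<-complement : ∀ {u v} → Lex< _≺_ u v → Lex< _≺′_ (complement u) (complement v)
  Lex<-complement prefix     = prefix
  Lex<-complement (here x≺y) = here (not-mono x≺y)
  Lex<-complement (there lt) = there (Lex<-complement lt)

  Lex≤-complement : ∀ {u v} → Lex≤ _≺_ u v → Lex≤ _≺′_ (complement u) (complement v)
  Lex≤-complement (inj₁ lt) = inj₁ (Lex<-complement lt)
  Lex≤-complement (inj₂ eq) = inj₂ (cong complement eq)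

  Lyndon-complement : ∀ {w} → Lyndon _≺_ w → Lyndon _≺′_ (complement w)
  Lyndon-complement {w} (w≢[] , ¬power , minimal) = w′≢[] , ¬power′ , minimal′
    where
    w′≢[] : complement w ≢ []
    w′≢[] eq = w≢[] (trans (sym (complement-involutive w)) (cong complement eq))

    ¬power′ : ¬ IsPower (complement w)
    ¬power′ power = ¬power (subst IsPower (complement-involutive w) (IsPower-complement power))

    minimal′ : ∀ u v → complement w ≡ u ++ v → Lex≤ _≺′_ (complement w) (v ++ u)
    minimal′ u v w′≡ = subst (Lex≤ _≺′_ (complement w)) rotation≡
      (Lex≤-complement (minimal (complement u) (complement v) w≡))
      where
      w≡ : w ≡ complement u ++ complement v
      w≡ = begin
        w                           ≡⟨ complement-involutive w ⟨
        complement (complement w)   ≡⟨ cong complement w′≡ ⟩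
        complement (u ++ v)         ≡⟨ map-++ not u v ⟩
        complement u ++ complement v ∎

      rotation≡ : complement (complement v ++ complement u) ≡ v ++ u
      rotation≡ = trans (map-++ not (complement v) (complement u))
        (cong₂ _++_ (complement-involutive v) (complement-involutive u))

LOdd-complement : ∀ {w} → LOdd w → LOdd (complement w)
LOdd-complement {w} (lyndon , odd-length) =
  swap lyndon , subst OddNat (sym (length-map not w)) odd-length
  where
  swap : LyndonEither w → LyndonEither (complement w)
  swap (inj₁ l) = inj₂ (Lyndon-complement (λ { f<t → t<f }) l)
  swap (inj₂ l) = inj₁ (Lyndon-complement (λ { t<f → f<t }) l)

-- Words 0001 R with R a product of the blocks 1 and 001

<₀₁-irrefl : ∀ x → ¬ x <₀₁ x
<₀₁-irrefl _ ()

<₁₀-irrefl : ∀ x → ¬ x <₁₀ x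
<₁₀-irrefl _ ()

data Blocks : BinWord → Set where
  []    : Blocks []
  1∷_   : ∀ {r} → Blocks r → Blocks (true ∷ r)
  001∷_ : ∀ {r} → Blocks r → Blocks (false ∷ false ∷ true ∷ r)

Blocks-++ : ∀ {l r} → Blocks l → Blocks r → Blocks (l ++ r)
Blocks-++ []        br = br
Blocks-++ (1∷ bl)   br = 1∷ Blocks-++ bl br
Blocks-++ (001∷ bl)  br = 001∷ Blocks-++ bl br

-- A nonempty suffix of a product of blocks has a 1 among its first three letters.
Blocks-suffix-above : ∀ {r} → Blocks r → ∀ u v → u ++ v ≡ r → v ≢ [] →
  ∀ {s} t → Lex< _<₀₁_ (false ∷ false ∷ false ∷ true ∷ s) (v ++ t)
Blocks-suffix-above []       []              _ refl v≢[] t = ⊥-elim (v≢[] refl)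
Blocks-suffix-above (1∷ b)   []              _ refl _    t = here f<t
Blocks-suffix-above (1∷ b)   (_ ∷ u)         v refl v≢[] t = Blocks-suffix-above b u v refl v≢[] t
Blocks-suffix-above (001∷ b) []              _ refl _    t = there (there (here f<t))
Blocks-suffix-above (001∷ b) (_ ∷ [])        _ refl _    t = there (here f<t)
Blocks-suffix-above (001∷ b) (_ ∷ _ ∷ [])    _ refl _    t = here f<t
Blocks-suffix-above (001∷ b) (_ ∷ _ ∷ _ ∷ u) v refl v≢[] t = Blocks-suffix-above b u v refl v≢[] t

-- 0001r is 0 followed by the block product 001r.
Lyndon-0001-Blocks : ∀ {r} → Blocks r → Lyndon _<₀₁_ (false ∷ false ∷ false ∷ true ∷ r)
Lyndon-0001-Blocks b = rotations-above⇒Lyndon <₀₁-irrefl (λ ()) above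
  where
  above : ∀ u v → u ≢ [] → v ≢ [] → _ ≡ u ++ v → Lex< _<₀₁_ _ (v ++ u)
  above []      v u≢[] _    _  = ⊥-elim (u≢[] refl)
  above (x ∷ u) v _    v≢[] w≡ =
    Blocks-suffix-above (001∷ b) u v (sym (∷-injectiveʳ w≡)) v≢[] (x ∷ u)

-- For 0 < 1 the rotation starting at 0000 is smaller, for 1 < 0 the one starting at the first 1.
¬LyndonEither-with-0000 : ∀ p q →
  ¬ LyndonEither (false ∷ false ∷ false ∷ true ∷ true ∷ p ++ false ∷ false ∷ false ∷ false ∷ q)
¬LyndonEither-with-0000 p q (inj₁ (_ , _ , minimal)) with
  Lex≤-first-difference <₀₁-irrefl (false ∷ false ∷ false ∷ []) (λ ())
    (minimal (false ∷ false ∷ false ∷ true ∷ true ∷ p) (false ∷ false ∷ false ∷ false ∷ q) refl)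
... | ()
¬LyndonEither-with-0000 p q (inj₂ (_ , _ , minimal)) with
  Lex≤-first-difference <₁₀-irrefl [] (λ ()) (minimal (false ∷ false ∷ false ∷ []) _ refl)
... | ()

module _ {m} (u v : Fin m) where

  h-++ : ∀ l r → h u v (l ++ r) ≡ h u v l ++ h u v r
  h-++ []      r = refl
  h-++ (x ∷ l) r with x ≟ u | x ≟ v
  ... | yes _ | _     = cong (false ∷_) (h-++ l r)
  ... | no _  | yes _ = cong (true ∷_) (h-++ l r)
  ... | no _  | no _  = h-++ l r

  h-first : ∀ w → h u v (u ∷ w) ≡ false ∷ h u v w
  h-first w with u ≟ u
  ... | yes _   = refl
  ... | no u≢u  = ⊥-elim (u≢u refl)

  h-second : u ≢ v → ∀ w → h u v (v ∷ w) ≡ true ∷ h u v w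
  h-second u≢v w with v ≟ u | v ≟ v
  ... | yes v≡u | _      = ⊥-elim (u≢v (sym v≡u))
  ... | no _    | yes _  = refl
  ... | no _    | no v≢v = ⊥-elim (v≢v refl)

  h-replicate-first : ∀ k → h u v (replicate k u) ≡ replicate k false
  h-replicate-first zero    = refl
  h-replicate-first (suc k) = trans (h-first _) (cong (false ∷_) (h-replicate-first k))

  h-other : ∀ {z} → z ≢ u → z ≢ v → ∀ w → h u v (z ∷ w) ≡ h u v w
  h-other {z} z≢u z≢v w with z ≟ u | z ≟ v
  ... | yes z≡u | _       = ⊥-elim (z≢u z≡u)
  ... | no _    | yes z≡v = ⊥-elim (z≢v z≡v)
  ... | no _    | no _    = refl

  h-replicate-other : ∀ {z} → z ≢ u → z ≢ v → ∀ k → h u v (replicate k z) ≡ []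
  h-replicate-other z≢u z≢v zero    = refl
  h-replicate-other z≢u z≢v (suc k) = trans (h-other z≢u z≢v _) (h-replicate-other z≢u z≢v k)

  h-swap : u ≢ v → ∀ w → h v u w ≡ complement (h u v w)
  h-swap u≢v []      = refl
  h-swap u≢v (x ∷ w) with x ≟ u | x ≟ v
  ... | yes refl | yes refl = ⊥-elim (u≢v refl)
  ... | yes refl | no _     = cong (true ∷_) (h-swap u≢v w)
  ... | no _     | yes refl = cong (false ∷_) (h-swap u≢v w)
  ... | no _     | no _     = h-swap u≢v w

count : ∀ {m} → Fin m → List (Fin m) → ℕ
count z w = length (filter (_≟ z) w)

count-++ : ∀ {m} (z : Fin m) l r → count z (l ++ r) ≡ count z l + count z r
count-++ z l r = trans (cong length (filter-++ (_≟ z) l r)) (length-++ (filter (_≟ z) l))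

length-h : ∀ {m} {u v : Fin m} → u ≢ v → ∀ w → length (h u v w) ≡ count u w + count v w
length-h u≢v [] = refl
length-h {u = u} {v} u≢v (x ∷ w) with x ≟ u | x ≟ v
... | yes refl | yes refl = ⊥-elim (u≢v refl)
... | yes refl | no _     = cong suc (length-h u≢v w)
... | no _     | yes refl = trans (cong suc (length-h u≢v w)) (sym (+-suc (count u w) (count v w)))
... | no _     | no _     = length-h u≢v w

odd-count-++ : ∀ {m} (z : Fin m) l r → odd (count z (l ++ r)) ≡ odd (count z l) xor odd (count z r)
odd-count-++ z l r = trans (cong odd (count-++ z l r)) (odd-+ (count z l) (count z r))

odd-length-h : ∀ {m} {u v : Fin m} → u ≢ v → ∀ w →
  odd (length (h u v w)) ≡ odd (count u w) xor odd (count v w)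
odd-length-h {u = u} {v} u≢v w = trans (cong odd (length-h u≢v w)) (odd-+ (count u w) (count v w))

GAdj-LOdd-sym : ∀ {m} {w : List (Fin m)} {u v} → GAdj LOdd w u v → GAdj LOdd w v u
GAdj-LOdd-sym {w = w} {u} {v} (u≢v , lodd) =
  u≢v ∘ sym , subst LOdd (sym (h-swap u v u≢v w)) (LOdd-complement lodd)

module _ {A : Set} where

  concatWhere : ∀ {n} → (Fin n → Bool) → (Fin n → List A) → List A
  concatWhere p f = concat (tabulate λ v → if p v then f v else [])

  concatWhere-closed : (P : List A → Set) → P [] → (∀ l r → P l → P r → P (l ++ r)) →
    ∀ {n} (p : Fin n → Bool) f → (∀ v → p v ≡ true → P (f v)) → P (concatWhere p f)
  concatWhere-closed P P[] P++ {zero}  p f Pf = P[]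
  concatWhere-closed P P[] P++ {suc n} p f Pf =
    P++ _ _ (head (p zero) refl) (concatWhere-closed P P[] P++ (p ∘ suc) (f ∘ suc) (Pf ∘ suc))
    where
    head : ∀ b → p zero ≡ b → P (if b then f zero else [])
    head true  p0 = Pf zero p0
    head false _  = P[]

  concatWhere-single : ∀ {n} (p : Fin n → Bool) f i → (∀ v → v ≢ i → p v ≡ true → f v ≡ []) →
    concatWhere p f ≡ (if p i then f i else [])
  concatWhere-single p f zero vanish =
    trans (cong ((if p zero then f zero else []) ++_) rest≡[]) (++-identityʳ _)
    where
    rest≡[] : concatWhere (p ∘ suc) (f ∘ suc) ≡ []
    rest≡[] = concatWhere-closed (_≡ []) refl (λ _ _ → cong₂ _++_) (p ∘ suc) (f ∘ suc)
      (λ v → vanish (suc v) (λ ()))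
  concatWhere-single p f (suc i) vanish =
    trans (cong (_++ concatWhere (p ∘ suc) (f ∘ suc)) head≡[])
      (concatWhere-single (p ∘ suc) (f ∘ suc) i (λ v v≢i → vanish (suc v) (v≢i ∘ suc-injective)))
    where
    head≡[] : (if p zero then f zero else []) ≡ []
    head≡[] with p zero in p0
    ... | true  = vanish zero (λ ()) p0
    ... | false = refl

  concatWhere-infix : ∀ {n} (p : Fin n → Bool) f i → p i ≡ true →
    ∃₂ λ l r → concatWhere p f ≡ l ++ f i ++ r
  concatWhere-infix p f zero p0 =
    [] , _ , cong (_++ concatWhere (p ∘ suc) (f ∘ suc)) (cong (if_then f zero else []) p0)
  concatWhere-infix p f (suc i) pi =
    let l , r , eq = concatWhere-infix (p ∘ suc) (f ∘ suc) i pi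
        head = if p zero then f zero else []
    in head ++ l , r , trans (cong (head ++_) eq) (sym (++-assoc head l _))

  ∈-concatWhere : ∀ {n} (p : Fin n → Bool) f {i z} → p i ≡ true → z ∈ f i → z ∈ concatWhere p f
  ∈-concatWhere p f {i} {z} pi z∈fi =
    ∈-concat⁺′ (subst (λ b → z ∈ (if b then f i else [])) (sym pi) z∈fi) (∈-tabulate⁺ i)

module _ {A B : Set} (F : List A → List B)
         (F-[] : F [] ≡ []) (F-++ : ∀ l r → F (l ++ r) ≡ F l ++ F r) where

  concatWhere-hom : ∀ {n} (p : Fin n → Bool) f → F (concatWhere p f) ≡ concatWhere p (F ∘ f)
  concatWhere-hom {zero}  p f = F-[]
  concatWhere-hom {suc n} p f =
    trans (F-++ _ _) (cong₂ _++_ head (concatWhere-hom (p ∘ suc) (f ∘ suc)))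
    where
    head : F (if p zero then f zero else []) ≡ (if p zero then F (f zero) else [])
    head with p zero
    ... | true  = refl
    ... | false = F-[]

-- The word of a properly 2-coloured graph

square : ∀ {A : Set} → List A → List A
square l = l ++ l

odd-count-square : ∀ {m} (z : Fin m) l → odd (count z (square l)) ≡ false
odd-count-square z l = trans (cong odd (count-++ z l l)) (odd-+-same (count z l))

Adj-sym : ∀ G {x y} → Adj G x y → Adj G y x
Adj-sym G {x} {y} xy = trans (Graph.sym G y x) xy

true≢false : true ≢ false
true≢false ()

module ColouredWord (G : Graph) (c : Vtx G → Bool) (proper : ∀ x y → Adj G x y → c x ≢ c y) where

  neighbours : Vtx G → List (Vtx G)
  neighbours v = concatWhere (adj G v) (_∷ [])

  trueTriples : List (Vtx G)
  trueTriples = concatWhere c (replicate 3)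

  falseVertices : List (Vtx G)
  falseVertices = concatWhere (not ∘ c) (_∷ [])

  gadget : Vtx G → List (Vtx G)
  gadget v = square (replicate 2 v ++ neighbours v)

  gadgets : List (Vtx G)
  gadgets = concatWhere c gadget

  word : List (Vtx G)
  word = trueTriples ++ square falseVertices ++ gadgets

  ∈-word : ∀ z → z ∈ word
  ∈-word z with c z in cz
  ... | true  = ∈-++⁺ˡ (∈-concatWhere c (replicate 3) cz (here refl))
  ... | false = ∈-++⁺ʳ trueTriples
    (∈-++⁺ˡ (∈-++⁺ˡ (∈-concatWhere (not ∘ c) (_∷ []) (cong not cz) (here refl))))

  odd-count-trueTriples : ∀ z → odd (count z trueTriples) ≡ c z
  odd-count-trueTriples z = begin
    odd (length (filter (_≟ z) trueTriples))
      ≡⟨ cong (odd ∘ length) (concatWhere-hom (filter (_≟ z)) refl (filter-++ (_≟ z)) c (replicate 3)) ⟩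
    odd (length (concatWhere c (filter (_≟ z) ∘ replicate 3)))
      ≡⟨ cong (odd ∘ length) (concatWhere-single c _ z vanish) ⟩
    odd (length (if c z then filter (_≟ z) (replicate 3 z) else []))
      ≡⟨ at-z ⟩
    c z ∎
    where
    vanish : ∀ v → v ≢ z → c v ≡ true → filter (_≟ z) (replicate 3 v) ≡ []
    vanish v v≢z _ = filter-none (_≟ z) (replicate⁺ 3 v≢z)

    at-z : odd (length (if c z then filter (_≟ z) (replicate 3 z) else [])) ≡ c z
    at-z with c z
    ... | true  = cong (odd ∘ length) (filter-all (_≟ z) (replicate⁺ 3 refl))
    ... | false = refl

  odd-count-gadgets : ∀ z → odd (count z gadgets) ≡ false
  odd-count-gadgets z = concatWhere-closed (λ l → odd (count z l) ≡ false) refl closed c gadget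
    (λ v _ → odd-count-square z (replicate 2 v ++ neighbours v))
    where
    closed : ∀ l r → odd (count z l) ≡ false → odd (count z r) ≡ false → odd (count z (l ++ r)) ≡ false
    closed l r l-even r-even = trans (odd-count-++ z l r) (cong₂ _xor_ l-even r-even)

  odd-count-word : ∀ z → odd (count z word) ≡ c z
  odd-count-word z = begin
    odd (count z word)
      ≡⟨ odd-count-++ z trueTriples _ ⟩
    odd (count z trueTriples) xor odd (count z (square falseVertices ++ gadgets))
      ≡⟨ cong (odd (count z trueTriples) xor_) (odd-count-++ z (square falseVertices) gadgets) ⟩
    odd (count z trueTriples) xor (odd (count z (square falseVertices)) xor odd (count z gadgets))
      ≡⟨ cong₂ (λ t s → t xor (s xor odd (count z gadgets)))
               (odd-count-trueTriples z) (odd-count-square z falseVertices) ⟩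
    c z xor odd (count z gadgets)
      ≡⟨ cong (c z xor_) (odd-count-gadgets z) ⟩
    c z xor false
      ≡⟨ xor-identityʳ (c z) ⟩
    c z ∎

  odd-length-h-word : ∀ {x y} → x ≢ y → odd (length (h x y word)) ≡ c x xor c y
  odd-length-h-word {x} {y} x≢y =
    trans (odd-length-h x≢y word) (cong₂ _xor_ (odd-count-word x) (odd-count-word y))

  module _ {a b : Vtx G} (ca : c a ≡ true) (cb : c b ≡ false) where

    true-coloured⇒≢b : ∀ {v} → c v ≡ true → v ≢ b
    true-coloured⇒≢b cv refl = true≢false (trans (sym cv) cb)

    false-coloured⇒≢a : ∀ {v} → c v ≡ false → v ≢ a
    false-coloured⇒≢a cv refl = true≢false (trans (sym ca) cv)

    a≢b : a ≢ b
    a≢b = true-coloured⇒≢b ca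

    oneIfAdj : Vtx G → BinWord
    oneIfAdj v = if adj G v b then true ∷ [] else []

    h-concatWhere : ∀ (p : Vtx G → Bool) f → h a b (concatWhere p f) ≡ concatWhere p (h a b ∘ f)
    h-concatWhere = concatWhere-hom (h a b) refl (h-++ a b)

    h-trueTriples : h a b trueTriples ≡ false ∷ false ∷ false ∷ []
    h-trueTriples = begin
      h a b trueTriples                            ≡⟨ h-concatWhere c (replicate 3) ⟩
      concatWhere c (h a b ∘ replicate 3)          ≡⟨ concatWhere-single c _ a vanish ⟩
      (if c a then h a b (replicate 3 a) else [])  ≡⟨ cong (if_then h a b (replicate 3 a) else []) ca ⟩
      h a b (replicate 3 a)                        ≡⟨ h-replicate-first a b 3 ⟩
      false ∷ false ∷ false ∷ []                   ∎
      where
      vanish : ∀ v → v ≢ a → c v ≡ true → h a b (replicate 3 v) ≡ []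
      vanish v v≢a cv = h-replicate-other a b v≢a (true-coloured⇒≢b cv) 3

    h-falseVertices : h a b falseVertices ≡ true ∷ []
    h-falseVertices = begin
      h a b falseVertices
        ≡⟨ h-concatWhere (not ∘ c) (_∷ []) ⟩
      concatWhere (not ∘ c) (λ v → h a b (v ∷ []))
        ≡⟨ concatWhere-single (not ∘ c) _ b vanish ⟩
      (if not (c b) then h a b (b ∷ []) else [])
        ≡⟨ cong (λ β → if not β then h a b (b ∷ []) else []) cb ⟩
      h a b (b ∷ [])
        ≡⟨ h-second a b a≢b [] ⟩
      true ∷ [] ∎
      where
      vanish : ∀ v → v ≢ b → not (c v) ≡ true → h a b (v ∷ []) ≡ []
      vanish v v≢b ¬cv = h-other a b (false-coloured⇒≢a (not≡⇒≡not ¬cv)) v≢b []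

    -- The neighbours of a true-coloured vertex are false-coloured, so none of them is a.
    h-neighbours : ∀ {v} → c v ≡ true → h a b (neighbours v) ≡ oneIfAdj v
    h-neighbours {v} cv = begin
      h a b (neighbours v)
        ≡⟨ h-concatWhere (adj G v) (_∷ []) ⟩
      concatWhere (adj G v) (λ u → h a b (u ∷ []))
        ≡⟨ concatWhere-single (adj G v) _ b vanish ⟩
      (if adj G v b then h a b (b ∷ []) else [])
        ≡⟨ cong (if adj G v b then_else []) (h-second a b a≢b []) ⟩
      oneIfAdj v ∎
      where
      vanish : ∀ u → u ≢ b → adj G v u ≡ true → h a b (u ∷ []) ≡ []
      vanish u u≢b vu = h-other a b (λ { refl → proper v u vu (trans cv (sym ca)) }) u≢b []

    h-gadget : ∀ {v} → c v ≡ true → h a b (gadget v) ≡ square (h a b (replicate 2 v) ++ oneIfAdj v)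
    h-gadget {v} cv = begin
      h a b (square (replicate 2 v ++ neighbours v))
        ≡⟨ h-++ a b (replicate 2 v ++ neighbours v) _ ⟩
      square (h a b (replicate 2 v ++ neighbours v))
        ≡⟨ cong square (h-++ a b (replicate 2 v) (neighbours v)) ⟩
      square (h a b (replicate 2 v) ++ h a b (neighbours v))
        ≡⟨ cong (λ n → square (h a b (replicate 2 v) ++ n)) (h-neighbours cv) ⟩
      square (h a b (replicate 2 v) ++ oneIfAdj v) ∎

    h-gadget-a : h a b (gadget a) ≡ square (false ∷ false ∷ oneIfAdj a)
    h-gadget-a = trans (h-gadget ca) (cong (λ z → square (z ++ oneIfAdj a)) (h-replicate-first a b 2))

    h-gadget-other : ∀ {v} → c v ≡ true → v ≢ a → h a b (gadget v) ≡ square (oneIfAdj v)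
    h-gadget-other {v} cv v≢a = trans (h-gadget cv)
      (cong (λ z → square (z ++ oneIfAdj v)) (h-replicate-other a b v≢a (true-coloured⇒≢b cv) 2))

    h-word : h a b word ≡ false ∷ false ∷ false ∷ true ∷ true ∷ h a b gadgets
    h-word = begin
      h a b word
        ≡⟨ h-++ a b trueTriples _ ⟩
      h a b trueTriples ++ h a b (square falseVertices ++ gadgets)
        ≡⟨ cong (h a b trueTriples ++_) (h-++ a b (square falseVertices) gadgets) ⟩
      h a b trueTriples ++ h a b (square falseVertices) ++ h a b gadgets
        ≡⟨ cong (λ s → h a b trueTriples ++ s ++ h a b gadgets) (h-++ a b falseVertices falseVertices) ⟩
      h a b trueTriples ++ square (h a b falseVertices) ++ h a b gadgets
        ≡⟨ cong₂ (λ t f → t ++ square f ++ h a b gadgets) h-trueTriples h-falseVertices ⟩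
      false ∷ false ∷ false ∷ true ∷ true ∷ h a b gadgets ∎

    Blocks-h-gadgets : Adj G a b → Blocks (h a b gadgets)
    Blocks-h-gadgets ab = subst Blocks (sym (h-concatWhere c gadget))
      (concatWhere-closed Blocks [] (λ _ _ → Blocks-++) c (h a b ∘ gadget) Blocks-h-gadget)
      where
      Blocks-h-gadget : ∀ v → c v ≡ true → Blocks (h a b (gadget v))
      Blocks-h-gadget v cv = by-cases (v ≟ a)
        where
        ones : Blocks (square (oneIfAdj v))
        ones with adj G v b
        ... | true  = 1∷ 1∷ []
        ... | false = []

        by-cases : Dec (v ≡ a) → Blocks (h a b (gadget v))
        by-cases (yes refl) = subst Blocks (sym h-gadget-a) zeros-one
          where
          zeros-one : Blocks (square (false ∷ false ∷ oneIfAdj a))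
          zeros-one rewrite ab = 001∷ 001∷ []
        by-cases (no v≢a) = subst Blocks (sym (h-gadget-other cv v≢a)) ones

    h-gadgets-0000 : adj G a b ≡ false →
      ∃₂ λ l r → h a b gadgets ≡ l ++ false ∷ false ∷ false ∷ false ∷ r
    h-gadgets-0000 ¬ab =
      let l , r , eq = concatWhere-infix c (h a b ∘ gadget) a ca
      in l , r , (begin
        h a b gadgets                         ≡⟨ h-concatWhere c gadget ⟩
        concatWhere c (h a b ∘ gadget)        ≡⟨ eq ⟩
        l ++ h a b (gadget a) ++ r            ≡⟨ cong (λ g → l ++ g ++ r) h-gadget-a ⟩
        l ++ square (false ∷ false ∷ oneIfAdj a) ++ r
          ≡⟨ cong (λ β → l ++ square (false ∷ false ∷ (if β then true ∷ [] else [])) ++ r) ¬ab ⟩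
        l ++ false ∷ false ∷ false ∷ false ∷ r ∎)

    Adj⇔GAdj-true-false : Adj G a b ⇔ GAdj LOdd word a b
    Adj⇔GAdj-true-false = mk⇔ adjacent⇒ ⇒adjacent
      where
      adjacent⇒ : Adj G a b → GAdj LOdd word a b
      adjacent⇒ ab = a≢b
        , inj₁ (subst (Lyndon _<₀₁_) (sym h-word) (Lyndon-0001-Blocks (1∷ Blocks-h-gadgets ab)))
        , odd⇒OddNat (trans (odd-length-h-word a≢b) (cong₂ _xor_ ca cb))

      ⇒adjacent : GAdj LOdd word a b → Adj G a b
      ⇒adjacent (_ , lyndon , _) with adj G a b in ab
      ... | true  = refl
      ... | false =
        let l , r , eq = h-gadgets-0000 ab
            word≡ = trans h-word (cong (λ g → false ∷ false ∷ false ∷ true ∷ true ∷ g) eq)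
        in ⊥-elim (¬LyndonEither-with-0000 l r (subst LyndonEither word≡ lyndon))

  same-colour-Adj⇔GAdj : ∀ {x y} → c x ≡ c y → Adj G x y ⇔ GAdj LOdd word x y
  same-colour-Adj⇔GAdj {x} {y} cx≡cy = mk⇔ (λ xy → ⊥-elim (proper x y xy cx≡cy)) (⊥-elim ∘ even-length)
    where
    even-length : ¬ GAdj LOdd word x y
    even-length (x≢y , _ , odd-length) = true≢false (begin
      true                            ≡⟨ OddNat⇒odd odd-length ⟨
      odd (length (h x y word))       ≡⟨ odd-length-h-word x≢y ⟩
      c x xor c y                     ≡⟨ cong (_xor c y) cx≡cy ⟩
      c y xor c y                     ≡⟨ xor-same (c y) ⟩
      false                           ∎)

  Adj⇔GAdj : ∀ x y → Adj G x y ⇔ GAdj LOdd word x y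
  Adj⇔GAdj x y with c x in cx | c y in cy
  ... | true  | false = Adj⇔GAdj-true-false cx cy
  ... | false | true  = mk⇔ (GAdj-LOdd-sym {w = word} ∘ Equivalence.to across ∘ Adj-sym G)
                            (Adj-sym G ∘ Equivalence.from across ∘ GAdj-LOdd-sym {w = word})
    where across = Adj⇔GAdj-true-false cy cx
  ... | true  | true  = same-colour-Adj⇔GAdj (trans cx (sym cy))
  ... | false | false = same-colour-Adj⇔GAdj (trans cx (sym cy))

InClass⇒Bipartite : ∀ G → InClass LOdd G → Bipartite G
InClass⇒Bipartite G (_ , w , _ , _ , f , Adj⇔GAdj) = colour , proper
  where
  colour : Vtx G → Bool
  colour x = odd (count (Bijection.to f x) w)

  proper : ∀ x y → Adj G x y → colour x ≢ colour y
  proper x y xy same with Equivalence.to (Adj⇔GAdj x y) xy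
  ... | u≢v , _ , odd-length = true≢false (begin
    true                                                     ≡⟨ OddNat⇒odd odd-length ⟨
    odd (length (h (Bijection.to f x) (Bijection.to f y) w)) ≡⟨ odd-length-h u≢v w ⟩
    colour x xor colour y                                    ≡⟨ cong (_xor colour y) same ⟩
    colour y xor colour y                                    ≡⟨ xor-same (colour y) ⟩
    false                                                    ∎)

Bipartite⇒InClass : ∀ G → Bipartite G → InClass LOdd G
Bipartite⇒InClass G (c , proper) = _ , word , word≢[] , ∈-word , ⤖-id (Vtx G) , Adj⇔GAdj
  where
  open ColouredWord G c proper

  word≢[] : word ≢ []
  word≢[] word≡[] with subst (zero ∈_) word≡[] (∈-word zero)
  ... | ()

mainTheorem12 : (G : Graph) → InClass LOdd G ⇔ Bipartite G
mainTheorem12 G = mk⇔ (InClass⇒Bipartite G) (Bipartite⇒InClass G)
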